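{- For all integers $\alpha\ge1$, $L_{2\alpha}=U_5(L_{2\alpha-1})$, and for all integers $\alpha\ge0$, $L_{2\alpha+1}=U_5(Z\cdot L_{2\alpha})$.
   Context: Let $q=e^{2\pi i\tau}$, $(q^k;q^k)_\infty=\prod_{m\ge1}(1-q^{km})$, $E_2(\tau)=1-24\sum_{n\ge1}\frac{nq^n}{1-q^n}$. Define integers $c(n)$ by $\sum_{n\ge0}c(n)q^n=\frac{2E_2(2\tau)-E_2(\tau)}{(q^2;q^2)_\infty}$. For $\alpha\ge1$ let $\lambda_{2\alpha-1}=\frac{1+7\cdot5^{2\alpha-1}}{12}$, $\lambda_{2\alpha}=\frac{1+11\cdot 5^{2\alpha}}{12}$, and define $L_0=2E_2(2\tau)-E_2(\tau)$, $L_{2\alpha-1}=(q^{10};q^{10})_\infty\sum_{n\ge0}c(5^{2\alpha-1}n+\lambda_{2\alpha-1})q^{n+1}$, $L_{2\alpha}=(q^{2};q^{2})_\infty\sum_{n\ge0}c(5^{2\alpha}n+\lambda_{2\alpha})q^{n+1}$. Let $Z(\tau)=\eta(50\tau)/\eta(2\tau)=q^2\prod_{m\ge1}\frac{1-q^{50m}}{1-q^{2m}}$. For a series $f=\sum_{m\ge M}a(m)q^m$, $U_5(f)=\sum_{5m\ge M}a(5m)q^m$. -}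

module Defs where

open import Data.Nat as ℕ using (ℕ; zero; suc; _∸_; _^_; NonZero)
open import Data.Nat.DivMod using (_/_)
open import Data.Nat.Divisibility using (_∣?_)
open import Data.Integer as ℤ using (ℤ; +_)
open import Data.Bool using (Bool; true; false; not; if_then_else_)
open import Relation.Nullary.Decidable using (does)

-- A formal power series in q with integer coefficients,
-- given by its coefficient function: f n = coefficient of q^n.
Series : Set
Series = ℕ → ℤ

sumTo : ℕ → (ℕ → ℤ) → ℤ
sumTo zero    h = h 0
sumTo (suc n) h = sumTo n h ℤ.+ h (suc n)

sum1To : ℕ → (ℕ → ℤ) → ℤ
sum1To zero    h = + 0
sum1To (suc n) h = sum1To n h ℤ.+ h (suc n)

oneS : Series
oneS zero    = + 1
oneS (suc _) = + 0

_⊕_ : Series → Series → Series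
(f ⊕ g) n = f n ℤ.+ g n

scale : ℤ → Series → Series
scale a f n = a ℤ.* f n

_⊛_ : Series → Series → Series
(f ⊛ g) n = sumTo n (λ i → f i ℤ.* g (n ∸ i))

shiftS : ℕ → Series → Series
shiftS k f n = if (does (ℕ._≤?_ k n)) then f (n ∸ k) else + 0

-- f(τ) ↦ f(kτ), i.e. q ↦ q^k
dilate : (k : ℕ) → .{{NonZero k}} → Series → Series
dilate k f n = if does (k ∣? n) then f (n / k) else + 0

prodTo : ℕ → (ℕ → Series) → Series
prodTo zero    F = oneS
prodTo (suc m) F = prodTo m F ⊛ F (suc m)

-- infinite product ∏_{m≥1} F m, for factors with F m ≡ 1 mod q^m:
-- the coefficient of q^n is that of the finite product over m ≤ n.
infProd : (ℕ → Series) → Series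
infProd F n = prodTo n F n

oneMinusQ : ℕ → Series
oneMinusQ m = oneS ⊕ scale (ℤ.- (+ 1)) (shiftS m oneS)

-- 1/(1 - q^m) = Σ_{j≥0} q^{mj}   (m ≥ 1)
geomQ : ℕ → Series
geomQ m n = if does (m ∣? n) then + 1 else + 0

qPoch : Series
qPoch = infProd oneMinusQ

qPochInv : Series
qPochInv = infProd geomQ

qPochK : (k : ℕ) → .{{NonZero k}} → Series
qPochK k = dilate k qPoch

-- Σ_{n≥1} n q^n/(1-q^n) = Σ_{N≥1} (Σ_{d∣N} d) q^N
lambertS : Series
lambertS N = sum1To N (λ d → if does (d ∣? N) then + d else + 0)

E2 : Series
E2 = oneS ⊕ scale (ℤ.- (+ 24)) lambertS

L0 : Series
L0 = scale (+ 2) (dilate 2 E2) ⊕ scale (ℤ.- (+ 1)) E2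

c : ℕ → ℤ
c = L0 ⊛ dilate 2 qPochInv

isOdd : ℕ → Bool
isOdd zero    = false
isOdd (suc n) = not (isOdd n)

lam : ℕ → ℕ
lam k = if isOdd k then (1 ℕ.+ 7 ℕ.* 5 ^ k) / 12 else (1 ℕ.+ 11 ℕ.* 5 ^ k) / 12

cSeries : ℕ → Series
cSeries k zero    = + 0
cSeries k (suc n) = c (5 ^ k ℕ.* n ℕ.+ lam k)

L : ℕ → Series
L zero    = L0
L (suc k) = if isOdd (suc k)
              then qPochK 10 ⊛ cSeries (suc k)
              else qPochK 2  ⊛ cSeries (suc k)

-- Z = η(50τ)/η(2τ) = q^2 (q^50;q^50)_∞ / (q^2;q^2)_∞
Z : Series
Z = shiftS 2 (qPochK 50 ⊛ dilate 2 qPochInv)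

U5 : Series → Series
U5 f m = f (5 ℕ.* m)

-- The L_k are, up to the factor (q²;q²)∞ (k even) or (q¹⁰;q¹⁰)∞ (k odd), generating functions of
-- the progressions c(5^k n + λ_k), so both identities are coefficient bookkeeping in ℤ[[q]].
-- U₅ passes through series in q⁵, U₅(f(q⁵)·g) = f·U₅(g), turning (q¹⁰;q¹⁰)∞ into (q²;q²)∞ and
-- (q⁵⁰;q⁵⁰)∞ into (q¹⁰;q¹⁰)∞; multiplying by Z cancels (q²;q²)∞ against 1/(q²;q²)∞, leaving
-- q²(q⁵⁰;q⁵⁰)∞. What remains is the shift of index: as 5^k ≡ 1 or 5 (mod 12) for k even or odd,
-- λ_{k+1} − λ_k is 2·5^k resp. 4·5^k, exactly the offset by which U₅ (after the factor q² in the
-- even case) carries the progression for λ_k onto the one for λ_{k+1}.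

module Submission where

open import Defs
open import Algebra.Bundles using (CommutativeMonoid)
import Algebra.Properties.CommutativeSemigroup as CommutativeSemigroupProperties
open import Data.Bool using (true; false; not; if_then_else_)
open import Data.Bool.Properties using (not-injective)
open import Data.Empty using (⊥-elim)
open import Data.Integer as ℤ using (ℤ; +_)
import Data.Integer.Properties as ℤ
open import Data.Nat as ℕ using (ℕ; zero; suc; _+_; _*_; _∸_; _^_; NonZero; _≤_; _<_; z≤n; s≤s)
import Data.Nat.Properties as ℕ
open import Data.Nat.DivMod using (_/_; m*n/n≡m; m*[n/m]≡n; m*n/m*o≡n/o)
open import Data.Nat.Divisibility
  using (_∣_; _∣?_; divides; ∣⇒≤; ∣-refl; ∣-trans; ∣m+n∣m⇒∣n; ∣m∸n∣n⇒∣m; m∣m*n; *-monoʳ-∣; *-cancelˡ-∣)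
open import Data.Nat.Tactic.RingSolver using (solve-∀)
open import Data.Product using (Σ; _×_; _,_)
open import Data.Sum using (inj₁; inj₂)
open import Level using (0ℓ)
open import Relation.Binary.Bundles using (Setoid)
open import Relation.Binary.PropositionalEquality
import Relation.Binary.Reasoning.Setoid
open import Relation.Nullary using (¬_; yes; no)

module ≗-Reasoning = Relation.Binary.Reasoning.Setoid (ℕ →-setoid ℤ)

sumTo-cong : ∀ n {h k} → (∀ i → i ≤ n → h i ≡ k i) → sumTo n h ≡ sumTo n k
sumTo-cong zero    h≡k = h≡k 0 z≤n
sumTo-cong (suc n) h≡k =
  cong₂ ℤ._+_ (sumTo-cong n (λ i i≤n → h≡k i (ℕ.m≤n⇒m≤1+n i≤n))) (h≡k (suc n) ℕ.≤-refl)

sumTo-const-0 : ∀ n → sumTo n (λ _ → + 0) ≡ + 0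
sumTo-const-0 zero    = refl
sumTo-const-0 (suc n) = cong (ℤ._+ + 0) (sumTo-const-0 n)

sumTo-zero : ∀ n {h} → (∀ i → i ≤ n → h i ≡ + 0) → sumTo n h ≡ + 0
sumTo-zero n h≡0 = trans (sumTo-cong n h≡0) (sumTo-const-0 n)

sumTo-+ : ∀ n h k → sumTo n (λ i → h i ℤ.+ k i) ≡ sumTo n h ℤ.+ sumTo n k
sumTo-+ zero    h k = refl
sumTo-+ (suc n) h k =
  trans (cong (ℤ._+ (h (suc n) ℤ.+ k (suc n))) (sumTo-+ n h k))
        (+-interchange (sumTo n h) (sumTo n k) (h (suc n)) (k (suc n)))
  where
  open CommutativeSemigroupProperties ℤ.+-commutativeSemigroup
    using () renaming (interchange to +-interchange)

sumTo-*ˡ : ∀ n a h → a ℤ.* sumTo n h ≡ sumTo n (λ i → a ℤ.* h i)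
sumTo-*ˡ zero    a h = refl
sumTo-*ˡ (suc n) a h =
  trans (ℤ.*-distribˡ-+ a (sumTo n h) (h (suc n))) (cong (ℤ._+ a ℤ.* h (suc n)) (sumTo-*ˡ n a h))

sumTo-*ʳ : ∀ n a h → sumTo n h ℤ.* a ≡ sumTo n (λ i → h i ℤ.* a)
sumTo-*ʳ n a h =
  trans (ℤ.*-comm (sumTo n h) a) (trans (sumTo-*ˡ n a h) (sumTo-cong n (λ i _ → ℤ.*-comm a (h i))))

sumTo-suc-front : ∀ n h → sumTo (suc n) h ≡ h 0 ℤ.+ sumTo n (λ i → h (suc i))
sumTo-suc-front zero    h = refl
sumTo-suc-front (suc n) h =
  trans (cong (ℤ._+ h (suc (suc n))) (sumTo-suc-front n h)) (ℤ.+-assoc (h 0) _ _)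

sumTo-reverse : ∀ n h → sumTo n h ≡ sumTo n (λ i → h (n ∸ i))
sumTo-reverse zero    h = refl
sumTo-reverse (suc n) h = begin
  sumTo n h ℤ.+ h (suc n)                   ≡⟨ ℤ.+-comm (sumTo n h) (h (suc n)) ⟩
  h (suc n) ℤ.+ sumTo n h                   ≡⟨ cong (λ s → h (suc n) ℤ.+ s) (sumTo-reverse n h) ⟩
  h (suc n) ℤ.+ sumTo n (λ i → h (n ∸ i))   ≡⟨ sumTo-suc-front n (λ i → h (suc n ∸ i)) ⟨
  sumTo (suc n) (λ i → h (suc n ∸ i))       ∎
  where open ≡-Reasoning

sumTo-+-vanishing : ∀ m r h → (∀ j → j < r → h (m + suc j) ≡ + 0) → sumTo (m + r) h ≡ sumTo m h
sumTo-+-vanishing m zero    h h≡0 rewrite ℕ.+-identityʳ m = refl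
sumTo-+-vanishing m (suc r) h h≡0 rewrite ℕ.+-suc m r = begin
  sumTo (m + r) h ℤ.+ h (suc (m + r))
    ≡⟨ cong₂ ℤ._+_ (sumTo-+-vanishing m r h (λ j j<r → h≡0 j (ℕ.m≤n⇒m≤1+n j<r)))
                   (trans (cong h (sym (ℕ.+-suc m r))) (h≡0 r ℕ.≤-refl)) ⟩
  sumTo m h ℤ.+ + 0
    ≡⟨ ℤ.+-identityʳ _ ⟩
  sumTo m h ∎
  where open ≡-Reasoning

sumTo-triangle : ∀ n (T : ℕ → ℕ → ℤ) →
  sumTo n (λ i → sumTo i (T i)) ≡ sumTo n (λ j → sumTo (n ∸ j) (λ k → T (j + k) j))
sumTo-triangle zero    T = refl
sumTo-triangle (suc n) T = begin
  sumTo n (λ i → sumTo i (T i)) ℤ.+ (sumTo n (T (suc n)) ℤ.+ T (suc n) (suc n))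
    ≡⟨ cong (ℤ._+ (sumTo n (T (suc n)) ℤ.+ T (suc n) (suc n))) (sumTo-triangle n T) ⟩
  R ℤ.+ (sumTo n (T (suc n)) ℤ.+ T (suc n) (suc n))
    ≡⟨ ℤ.+-assoc R _ _ ⟨
  R ℤ.+ sumTo n (T (suc n)) ℤ.+ T (suc n) (suc n)
    ≡⟨ cong₂ ℤ._+_ (sym (sumTo-+ n _ _)) (cong (λ m → T m (suc n)) (sym (ℕ.+-identityʳ (suc n)))) ⟩
  sumTo n (λ j → sumTo (n ∸ j) (λ k → T (j + k) j) ℤ.+ T (suc n) j) ℤ.+ T (suc n + 0) (suc n)
    ≡⟨ cong₂ ℤ._+_ (sumTo-cong n column) (cong (λ m → sumTo m (λ k → T (suc n + k) (suc n))) (sym (ℕ.n∸n≡0 n))) ⟩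
  sumTo (suc n) (λ j → sumTo (suc n ∸ j) (λ k → T (j + k) j)) ∎
  where
  open ≡-Reasoning
  R : ℤ
  R = sumTo n (λ j → sumTo (n ∸ j) (λ k → T (j + k) j))
  column : ∀ j → j ≤ n →
    sumTo (n ∸ j) (λ k → T (j + k) j) ℤ.+ T (suc n) j ≡ sumTo (suc n ∸ j) (λ k → T (j + k) j)
  column j j≤n rewrite ℕ.+-∸-assoc 1 j≤n =
    cong (λ m → sumTo (n ∸ j) (λ k → T (j + k) j) ℤ.+ T m j)
      (trans (cong suc (sym (ℕ.m+[n∸m]≡n j≤n))) (sym (ℕ.+-suc j (n ∸ j))))

⊛-cong : ∀ {f f′ g g′} → f ≗ f′ → g ≗ g′ → f ⊛ g ≗ f′ ⊛ g′
⊛-cong f≗f′ g≗g′ n = sumTo-cong n (λ i _ → cong₂ ℤ._*_ (f≗f′ i) (g≗g′ (n ∸ i)))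

⊛-congˡ : ∀ {f f′} g → f ≗ f′ → f ⊛ g ≗ f′ ⊛ g
⊛-congˡ {f} {f′} g f≗f′ = ⊛-cong {f} {f′} {g} {g} f≗f′ (λ _ → refl)

⊛-congʳ : ∀ f {g g′} → g ≗ g′ → f ⊛ g ≗ f ⊛ g′
⊛-congʳ f {g} {g′} = ⊛-cong {f} {f} {g} {g′} (λ _ → refl)

⊛-comm : ∀ f g → f ⊛ g ≗ g ⊛ f
⊛-comm f g n = trans (sumTo-reverse n _) (sumTo-cong n (λ i i≤n →
  trans (cong (λ m → f (n ∸ i) ℤ.* g m) (ℕ.m∸[m∸n]≡n i≤n)) (ℤ.*-comm (f (n ∸ i)) (g i))))

⊛-assoc : ∀ f g h → (f ⊛ g) ⊛ h ≗ f ⊛ (g ⊛ h)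
⊛-assoc f g h n = begin
  sumTo n (λ i → sumTo i (λ j → f j ℤ.* g (i ∸ j)) ℤ.* h (n ∸ i))
    ≡⟨ sumTo-cong n (λ i _ → sumTo-*ʳ i (h (n ∸ i)) _) ⟩
  sumTo n (λ i → sumTo i (λ j → f j ℤ.* g (i ∸ j) ℤ.* h (n ∸ i)))
    ≡⟨ sumTo-triangle n (λ i j → f j ℤ.* g (i ∸ j) ℤ.* h (n ∸ i)) ⟩
  sumTo n (λ j → sumTo (n ∸ j) (λ k → f j ℤ.* g (j + k ∸ j) ℤ.* h (n ∸ (j + k))))
    ≡⟨ sumTo-cong n (λ j _ → sumTo-cong (n ∸ j) (λ k _ →
        trans (cong₂ (λ a b → f j ℤ.* g a ℤ.* h b) (ℕ.m+n∸m≡n j k) (sym (ℕ.∸-+-assoc n j k)))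
              (ℤ.*-assoc (f j) (g k) (h (n ∸ j ∸ k))))) ⟩
  sumTo n (λ j → sumTo (n ∸ j) (λ k → f j ℤ.* (g k ℤ.* h (n ∸ j ∸ k))))
    ≡⟨ sumTo-cong n (λ j _ → sym (sumTo-*ˡ (n ∸ j) (f j) _)) ⟩
  sumTo n (λ j → f j ℤ.* sumTo (n ∸ j) (λ k → g k ℤ.* h (n ∸ j ∸ k))) ∎
  where open ≡-Reasoning

⊛-identityʳ-upTo : ∀ f g j → (∀ k → k ≤ j → g k ≡ oneS k) → (f ⊛ g) j ≡ f j
⊛-identityʳ-upTo f g zero    g≡1 = trans (cong (f 0 ℤ.*_) (g≡1 0 z≤n)) (ℤ.*-identityʳ (f 0))
⊛-identityʳ-upTo f g (suc j) g≡1 = begin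
  sumTo j (λ i → f i ℤ.* g (suc j ∸ i)) ℤ.+ f (suc j) ℤ.* g (suc j ∸ suc j)
    ≡⟨ cong₂ ℤ._+_ (sumTo-zero j (λ i i≤j → trans (cong (f i ℤ.*_) (g-pos i i≤j)) (ℤ.*-zeroʳ (f i))))
                   (cong (f (suc j) ℤ.*_) (trans (cong g (ℕ.n∸n≡0 j)) (g≡1 0 z≤n))) ⟩
  + 0 ℤ.+ f (suc j) ℤ.* + 1
    ≡⟨ trans (ℤ.+-identityˡ _) (ℤ.*-identityʳ (f (suc j))) ⟩
  f (suc j) ∎
  where
  open ≡-Reasoning
  g-pos : ∀ i → i ≤ j → g (suc j ∸ i) ≡ + 0
  g-pos i i≤j rewrite ℕ.+-∸-assoc 1 i≤j = g≡1 (suc (j ∸ i)) (s≤s (ℕ.m∸n≤m j i))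

⊛-identityʳ : ∀ f → f ⊛ oneS ≗ f
⊛-identityʳ f n = ⊛-identityʳ-upTo f oneS n (λ _ _ → refl)

⊛-identityˡ : ∀ f → oneS ⊛ f ≗ f
⊛-identityˡ f n = trans (⊛-comm oneS f n) (⊛-identityʳ f n)

⊛-distribʳ-⊕ : ∀ f g h → (f ⊕ g) ⊛ h ≗ (f ⊛ h) ⊕ (g ⊛ h)
⊛-distribʳ-⊕ f g h n =
  trans (sumTo-cong n (λ i _ → ℤ.*-distribʳ-+ (h (n ∸ i)) (f i) (g i))) (sumTo-+ n _ _)

scale-⊛ : ∀ a f g → scale a f ⊛ g ≗ scale a (f ⊛ g)
scale-⊛ a f g n = trans (sumTo-cong n (λ i _ → ℤ.*-assoc a (f i) (g (n ∸ i)))) (sym (sumTo-*ˡ n a _))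

⊛-commutativeMonoid : CommutativeMonoid 0ℓ 0ℓ
⊛-commutativeMonoid = record
  { Carrier = Series
  ; _≈_ = _≗_
  ; _∙_ = _⊛_
  ; ε = oneS
  ; isCommutativeMonoid = record
    { isMonoid = record
      { isSemigroup = record
        { isMagma = record
          { isEquivalence = Setoid.isEquivalence (ℕ →-setoid ℤ)
          ; ∙-cong = ⊛-cong
          }
        ; assoc = ⊛-assoc
        }
      ; identity = ⊛-identityˡ , ⊛-identityʳ
      }
    ; comm = ⊛-comm
    }
  }

open CommutativeSemigroupProperties (CommutativeMonoid.commutativeSemigroup ⊛-commutativeMonoid)
  using () renaming (interchange to ⊛-interchange; x∙yz≈y∙xz to ⊛-x∙yz≈y∙xz)

shiftS-≥ : ∀ k f n → k ≤ n → shiftS k f n ≡ f (n ∸ k)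
shiftS-≥ k f n k≤n with k ℕ.≤ᵇ n | ℕ.≤⇒≤ᵇ k≤n
... | true | _ = refl

shiftS-< : ∀ k f n → n < k → shiftS k f n ≡ + 0
shiftS-< k f n n<k with k ℕ.≤ᵇ n | ℕ.≤ᵇ⇒≤ k n
... | false | _      = refl
... | true  | k≤ᵇn⇒ = ⊥-elim (ℕ.<⇒≱ n<k (k≤ᵇn⇒ _))

shiftS-cong : ∀ k {f g} → f ≗ g → shiftS k f ≗ shiftS k g
shiftS-cong k f≗g n with k ℕ.≤ᵇ n
... | true  = f≗g (n ∸ k)
... | false = refl

⊛-shiftS : ∀ k f g → f ⊛ shiftS k g ≗ shiftS k (f ⊛ g)
⊛-shiftS k f g n with ℕ.≤-<-connex k n
... | inj₂ n<k = trans (sumTo-zero n (λ i i≤n → trans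
        (cong (f i ℤ.*_) (shiftS-< k g (n ∸ i) (ℕ.≤-<-trans (ℕ.m∸n≤m n i) n<k))) (ℤ.*-zeroʳ (f i))))
      (sym (shiftS-< k (f ⊛ g) n n<k))
... | inj₁ k≤n = begin
  sumTo n term
    ≡⟨ cong (λ m → sumTo m term) (ℕ.m∸n+n≡m k≤n) ⟨
  sumTo (n ∸ k + k) term
    ≡⟨ sumTo-+-vanishing (n ∸ k) k term (λ j j<k → trans
         (cong (f (n ∸ k + suc j) ℤ.*_) (shiftS-< k g _ (tail-index j j<k))) (ℤ.*-zeroʳ (f (n ∸ k + suc j)))) ⟩
  sumTo (n ∸ k) term
    ≡⟨ sumTo-cong (n ∸ k) (λ i i≤n∸k → cong (f i ℤ.*_)
         (trans (shiftS-≥ k g (n ∸ i) (head-bound i i≤n∸k)) (cong g (∸-swap i)))) ⟩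
  (f ⊛ g) (n ∸ k)
    ≡⟨ shiftS-≥ k (f ⊛ g) n k≤n ⟨
  shiftS k (f ⊛ g) n ∎
  where
  open ≡-Reasoning
  term : ℕ → ℤ
  term i = f i ℤ.* shiftS k g (n ∸ i)
  tail-index : ∀ j → j < k → n ∸ (n ∸ k + suc j) < k
  tail-index j j<k = subst (_< k)
    (trans (cong (_∸ suc j) (sym (ℕ.m∸[m∸n]≡n k≤n))) (ℕ.∸-+-assoc n (n ∸ k) (suc j)))
    (ℕ.∸-monoʳ-< (s≤s z≤n) j<k)
  head-bound : ∀ i → i ≤ n ∸ k → k ≤ n ∸ i
  head-bound i i≤n∸k = ℕ.m+n≤o⇒m≤o∸n k (subst (_≤ n) (ℕ.+-comm i k) (ℕ.m≤o∸n⇒m+n≤o i k≤n i≤n∸k))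
  ∸-swap : ∀ i → n ∸ i ∸ k ≡ n ∸ k ∸ i
  ∸-swap i = trans (ℕ.∸-+-assoc n i k) (trans (cong (n ∸_) (ℕ.+-comm i k)) (sym (ℕ.∸-+-assoc n k i)))

U : ℕ → Series → Series
U d f m = f (d * m)

VanishesOffMultiplesOf : ℕ → Series → Set
VanishesOffMultiplesOf d f = ∀ n → ¬ d ∣ n → f n ≡ + 0

∤-multiple+small : ∀ d n j → suc j < d → ¬ d ∣ d * n + suc j
∤-multiple+small d n j j<d d∣ = ℕ.<⇒≱ j<d (∣⇒≤ (∣m+n∣m⇒∣n d∣ (m∣m*n n)))

sumTo-decimate : ∀ d .{{_ : NonZero d}} h → VanishesOffMultiplesOf d h →
  ∀ n → sumTo (d * n) h ≡ sumTo n (λ j → h (d * j))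
sumTo-decimate (suc d′) h h≡0 zero rewrite ℕ.*-zeroʳ d′ = refl
sumTo-decimate d@(suc d′) h h≡0 (suc n) = begin
  sumTo (d * suc n) h
    ≡⟨ cong (λ m → sumTo m h) d[1+n]≡ ⟩
  sumTo (d * n + d′) h ℤ.+ h (suc (d * n + d′))
    ≡⟨ cong₂ ℤ._+_ (sumTo-+-vanishing (d * n) d′ h (λ j j<d′ → h≡0 _ (∤-multiple+small d n j (s≤s j<d′))))
                   (cong h (sym d[1+n]≡)) ⟩
  sumTo (d * n) h ℤ.+ h (d * suc n)
    ≡⟨ cong (ℤ._+ h (d * suc n)) (sumTo-decimate d h h≡0 n) ⟩
  sumTo n (λ j → h (d * j)) ℤ.+ h (d * suc n) ∎
  where
  open ≡-Reasoning
  d[1+n]≡ : d * suc n ≡ suc (d * n + d′)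
  d[1+n]≡ = trans (ℕ.*-suc d n) (cong suc (ℕ.+-comm d′ (d * n)))

module _ (d : ℕ) .{{_ : NonZero d}} where

  dilate-∣ : ∀ f n → d ∣ n → dilate d f n ≡ f (n / d)
  dilate-∣ f n d∣n with d ∣? n
  ... | yes _   = refl
  ... | no  d∤n = ⊥-elim (d∤n d∣n)

  dilate-vanishesOff : ∀ f → VanishesOffMultiplesOf d (dilate d f)
  dilate-vanishesOff f n d∤n with d ∣? n
  ... | yes d∣n = ⊥-elim (d∤n d∣n)
  ... | no  _   = refl

  dilate-cong : ∀ {f g} → f ≗ g → dilate d f ≗ dilate d g
  dilate-cong f≗g n with d ∣? n
  ... | yes _ = f≗g (n / d)
  ... | no  _ = refl

  U-dilate : ∀ f → U d (dilate d f) ≗ f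
  U-dilate f m = trans (dilate-∣ f (d * m) (m∣m*n m))
                       (cong f (trans (cong (_/ d) (ℕ.*-comm d m)) (m*n/n≡m m d)))

  dilate-U : ∀ f → VanishesOffMultiplesOf d f → dilate d (U d f) ≗ f
  dilate-U f f≡0 n with d ∣? n
  ... | yes d∣n = cong f (m*[n/m]≡n d∣n)
  ... | no  d∤n = sym (f≡0 n d∤n)

  U-dilate-⊛ : ∀ f g → U d (dilate d f ⊛ g) ≗ f ⊛ U d g
  U-dilate-⊛ f g m = begin
    sumTo (d * m) (λ i → dilate d f i ℤ.* g (d * m ∸ i))
      ≡⟨ sumTo-decimate d _ (λ i d∤i → trans (cong (ℤ._* g (d * m ∸ i)) (dilate-vanishesOff f i d∤i))
                                              (ℤ.*-zeroˡ (g (d * m ∸ i)))) m ⟩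
    sumTo m (λ j → dilate d f (d * j) ℤ.* g (d * m ∸ d * j))
      ≡⟨ sumTo-cong m (λ j _ → cong₂ ℤ._*_ (U-dilate f j) (cong g (sym (ℕ.*-distribˡ-∸ d m j)))) ⟩
    sumTo m (λ j → f j ℤ.* g (d * (m ∸ j))) ∎
    where open ≡-Reasoning

⊛-vanishesOff : ∀ d {f g} → VanishesOffMultiplesOf d f → VanishesOffMultiplesOf d g →
  VanishesOffMultiplesOf d (f ⊛ g)
⊛-vanishesOff d {f} {g} f≡0 g≡0 n d∤n = sumTo-zero n term≡0
  where
  term≡0 : ∀ i → i ≤ n → f i ℤ.* g (n ∸ i) ≡ + 0
  term≡0 i i≤n with d ∣? i
  ... | yes d∣i = trans (cong (f i ℤ.*_) (g≡0 (n ∸ i) (λ d∣n∸i → d∤n (∣m∸n∣n⇒∣m d i≤n d∣n∸i d∣i))))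
                        (ℤ.*-zeroʳ (f i))
  ... | no  d∤i = trans (cong (ℤ._* g (n ∸ i)) (f≡0 i d∤i)) (ℤ.*-zeroˡ (g (n ∸ i)))

-- A product of series in q^d is again one, so it is recovered from its image under U d.
dilate-⊛ : ∀ d .{{_ : NonZero d}} f g → dilate d (f ⊛ g) ≗ dilate d f ⊛ dilate d g
dilate-⊛ d f g = begin
  dilate d (f ⊛ g)                            ≈⟨ dilate-cong d (⊛-congʳ f (U-dilate d g)) ⟨
  dilate d (f ⊛ U d (dilate d g))             ≈⟨ dilate-cong d (U-dilate-⊛ d f (dilate d g)) ⟨
  dilate d (U d (dilate d f ⊛ dilate d g))    ≈⟨ dilate-U d _ (⊛-vanishesOff d (dilate-vanishesOff d f) (dilate-vanishesOff d g)) ⟩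
  dilate d f ⊛ dilate d g                     ∎
  where open ≗-Reasoning

dilate-* : ∀ d k .{{_ : NonZero d}} .{{_ : NonZero k}} .{{_ : NonZero (d * k)}} f →
  dilate (d * k) f ≗ dilate d (dilate k f)
dilate-* d k f = begin
  dilate (d * k) f                  ≈⟨ dilate-U d _ vanishesOff ⟨
  dilate d (U d (dilate (d * k) f)) ≈⟨ dilate-cong d U-dilate-* ⟩
  dilate d (dilate k f)             ∎
  where
  open ≗-Reasoning
  vanishesOff : VanishesOffMultiplesOf d (dilate (d * k) f)
  vanishesOff n d∤n = dilate-vanishesOff (d * k) f n (λ dk∣n → d∤n (∣-trans (m∣m*n k) dk∣n))
  U-dilate-* : U d (dilate (d * k) f) ≗ dilate k f
  U-dilate-* m with k ∣? m
  ... | yes k∣m = trans (dilate-∣ (d * k) f (d * m) (*-monoʳ-∣ d k∣m)) (cong f (m*n/m*o≡n/o d m k))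
  ... | no  k∤m = dilate-vanishesOff (d * k) f (d * m) (λ dk∣dm → k∤m (*-cancelˡ-∣ d dk∣dm))

IsOneModQ^m : (ℕ → Series) → Set
IsOneModQ^m F = ∀ m j → j ≤ m → F (suc m) j ≡ oneS j

prodTo-stable : ∀ {F} → IsOneModQ^m F → ∀ j N → j ≤ N → prodTo N F j ≡ infProd F j
prodTo-stable {F} F≡1 j N j≤N =
  trans (cong (λ M → prodTo M F j) (sym (ℕ.m+[n∸m]≡n j≤N))) (stable-+ (N ∸ j))
  where
  stable-+ : ∀ t → prodTo (j + t) F j ≡ prodTo j F j
  stable-+ zero    rewrite ℕ.+-identityʳ j = refl
  stable-+ (suc t) rewrite ℕ.+-suc j t =
    trans (⊛-identityʳ-upTo (prodTo (j + t) F) (F (suc (j + t))) j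
             (λ k k≤j → F≡1 (j + t) k (ℕ.≤-trans k≤j (ℕ.m≤m+n j t))))
          (stable-+ t)

prodTo-⊛ : ∀ n F G → prodTo n F ⊛ prodTo n G ≗ prodTo n (λ m → F m ⊛ G m)
prodTo-⊛ zero    F G = ⊛-identityʳ oneS
prodTo-⊛ (suc n) F G n′ =
  trans (⊛-interchange (prodTo n F) (F (suc n)) (prodTo n G) (G (suc n)) n′)
        (⊛-congˡ (F (suc n) ⊛ G (suc n)) (prodTo-⊛ n F G) n′)

infProd-⊛ : ∀ {F G} → IsOneModQ^m F → IsOneModQ^m G → infProd F ⊛ infProd G ≗ infProd (λ m → F m ⊛ G m)
infProd-⊛ {F} {G} F≡1 G≡1 n = trans
  (sumTo-cong n (λ i i≤n → sym (cong₂ ℤ._*_ (prodTo-stable F≡1 i n i≤n)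
                                          (prodTo-stable G≡1 (n ∸ i) n (ℕ.m∸n≤m n i)))))
  (prodTo-⊛ n F G n)

prodTo-oneS : ∀ n H → (∀ m → H (suc m) ≗ oneS) → prodTo n H ≗ oneS
prodTo-oneS zero    H H≗1 = λ _ → refl
prodTo-oneS (suc n) H H≗1 k = trans (⊛-cong (prodTo-oneS n H H≗1) (H≗1 n) k) (⊛-identityʳ oneS k)

infProd-oneS : ∀ H → (∀ m → H (suc m) ≗ oneS) → infProd H ≗ oneS
infProd-oneS H H≗1 n = prodTo-oneS n H H≗1 n

geomQ-∤ : ∀ m n → ¬ m ∣ n → geomQ m n ≡ + 0
geomQ-∤ m n m∤n with m ∣? n
... | yes m∣n = ⊥-elim (m∤n m∣n)
... | no  _   = refl

geomQ-periodic : ∀ m n → m ≤ n → geomQ m n ≡ geomQ m (n ∸ m)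
geomQ-periodic m n m≤n with m ∣? n | m ∣? (n ∸ m)
... | yes _   | yes _   = refl
... | no  _   | no  _   = refl
... | yes m∣n | no  m∤n∸m = ⊥-elim (m∤n∸m (∣m+n∣m⇒∣n (subst (m ∣_) (sym (ℕ.m+[n∸m]≡n m≤n)) m∣n) ∣-refl))
... | no  m∤n | yes m∣n∸m = ⊥-elim (m∤n (∣m∸n∣n⇒∣m m m≤n m∣n∸m ∣-refl))

geomQ-isOneModQ^m : IsOneModQ^m geomQ
geomQ-isOneModQ^m m zero    _   = refl
geomQ-isOneModQ^m m (suc j) j≤m = geomQ-∤ (suc m) (suc j) (λ m∣j → ℕ.<⇒≱ (s≤s j≤m) (∣⇒≤ m∣j))

oneMinusQ-isOneModQ^m : IsOneModQ^m oneMinusQ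
oneMinusQ-isOneModQ^m m j j≤m =
  trans (cong (λ x → oneS j ℤ.+ ℤ.-1ℤ ℤ.* x) (shiftS-< (suc m) oneS j (s≤s j≤m))) (ℤ.+-identityʳ (oneS j))

geomQ-⊛-oneMinusQ : ∀ m → geomQ (suc m) ⊛ oneMinusQ (suc m) ≗ oneS
geomQ-⊛-oneMinusQ m = begin
  g ⊛ oneMinusQ M                                  ≈⟨ ⊛-comm g (oneMinusQ M) ⟩
  (oneS ⊕ scale ℤ.-1ℤ (shiftS M oneS)) ⊛ g         ≈⟨ ⊛-distribʳ-⊕ oneS (scale ℤ.-1ℤ (shiftS M oneS)) g ⟩
  (oneS ⊛ g) ⊕ (scale ℤ.-1ℤ (shiftS M oneS) ⊛ g)   ≈⟨ (λ n → cong₂ ℤ._+_ (⊛-identityˡ g n) (scale-⊛ ℤ.-1ℤ (shiftS M oneS) g n)) ⟩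
  g ⊕ scale ℤ.-1ℤ (shiftS M oneS ⊛ g)              ≈⟨ (λ n → cong (λ x → g n ℤ.+ ℤ.-1ℤ ℤ.* x) (shifted n)) ⟩
  g ⊕ scale ℤ.-1ℤ (shiftS M g)                     ≈⟨ telescope ⟩
  oneS                                             ∎
  where
  open ≗-Reasoning
  M = suc m
  g = geomQ M
  shifted : shiftS M oneS ⊛ g ≗ shiftS M g
  shifted n = trans (⊛-comm (shiftS M oneS) g n)
                    (trans (⊛-shiftS M g oneS n) (shiftS-cong M (⊛-identityʳ g) n))
  telescope : g ⊕ scale ℤ.-1ℤ (shiftS M g) ≗ oneS
  telescope n with ℕ.≤-<-connex M n
  ... | inj₂ n<M = trans (cong (λ x → g n ℤ.+ ℤ.-1ℤ ℤ.* x) (shiftS-< M g n n<M))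
                         (trans (ℤ.+-identityʳ (g n)) (geomQ-isOneModQ^m m n (ℕ.≤-pred n<M)))
  telescope n@(suc _) | inj₁ M≤n =
    trans (cong (λ x → g n ℤ.+ ℤ.-1ℤ ℤ.* x) (trans (shiftS-≥ M g n M≤n) (sym (geomQ-periodic M n M≤n))))
          (trans (cong (λ x → g n ℤ.+ x) (ℤ.-1*i≡-i (g n))) (ℤ.+-inverseʳ (g n)))

qPochInv-⊛-qPoch : qPochInv ⊛ qPoch ≗ oneS
qPochInv-⊛-qPoch n =
  trans (infProd-⊛ geomQ-isOneModQ^m oneMinusQ-isOneModQ^m n)
        (infProd-oneS (λ m → geomQ m ⊛ oneMinusQ m) geomQ-⊛-oneMinusQ n)

isOdd-double : ∀ α → isOdd (2 * α) ≡ false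
isOdd-double zero    = refl
isOdd-double (suc α) = trans (cong isOdd (ℕ.*-suc 2 α)) (cong (λ b → not (not b)) (isOdd-double α))

5^-mod-12 : ∀ k → Σ ℕ λ a → 5 ^ k ≡ 12 * a + (if isOdd k then 5 else 1)
5^-mod-12 zero = 0 , refl
5^-mod-12 (suc k) with isOdd k | 5^-mod-12 k
... | false | a , 5^k≡ = 5 * a , trans (cong (5 *_) 5^k≡) (from-1 a)
  where from-1 : ∀ a → 5 * (12 * a + 1) ≡ 12 * (5 * a) + 5
        from-1 = solve-∀
... | true  | a , 5^k≡ = 5 * a + 2 , trans (cong (5 *_) 5^k≡) (from-5 a)
  where from-5 : ∀ a → 5 * (12 * a + 5) ≡ 12 * (5 * a + 2) + 1
        from-5 = solve-∀

/12-exact : ∀ m n → m ≡ n * 12 → m / 12 ≡ n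
/12-exact m n m≡n*12 = trans (cong (_/ 12) m≡n*12) (m*n/n≡m n 12)

lam-suc-even : ∀ k → isOdd k ≡ false → lam (suc k) ≡ lam k + 2 * 5 ^ k
lam-suc-even k even with 5^-mod-12 k
... | a , 5^k≡ rewrite even | 5^k≡ = begin
  (1 + 7 * (5 * (12 * a + 1))) / 12
    ≡⟨ /12-exact _ (35 * a + 3) (odd-numerator a) ⟩
  35 * a + 3
    ≡⟨ step a ⟩
  (11 * a + 1) + 2 * (12 * a + 1)
    ≡⟨ cong (_+ 2 * (12 * a + 1)) (/12-exact _ (11 * a + 1) (even-numerator a)) ⟨
  (1 + 11 * (12 * a + 1)) / 12 + 2 * (12 * a + 1) ∎
  where
  open ≡-Reasoning
  odd-numerator : ∀ a → 1 + 7 * (5 * (12 * a + 1)) ≡ (35 * a + 3) * 12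
  odd-numerator = solve-∀
  even-numerator : ∀ a → 1 + 11 * (12 * a + 1) ≡ (11 * a + 1) * 12
  even-numerator = solve-∀
  step : ∀ a → 35 * a + 3 ≡ (11 * a + 1) + 2 * (12 * a + 1)
  step = solve-∀

lam-suc-odd : ∀ k → isOdd k ≡ true → lam (suc k) ≡ lam k + 4 * 5 ^ k
lam-suc-odd k odd with 5^-mod-12 k
... | a , 5^k≡ rewrite odd | 5^k≡ = begin
  (1 + 11 * (5 * (12 * a + 5))) / 12
    ≡⟨ /12-exact _ (55 * a + 23) (even-numerator a) ⟩
  55 * a + 23
    ≡⟨ step a ⟩
  (7 * a + 3) + 4 * (12 * a + 5)
    ≡⟨ cong (_+ 4 * (12 * a + 5)) (/12-exact _ (7 * a + 3) (odd-numerator a)) ⟨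
  (1 + 7 * (12 * a + 5)) / 12 + 4 * (12 * a + 5) ∎
  where
  open ≡-Reasoning
  even-numerator : ∀ a → 1 + 11 * (5 * (12 * a + 5)) ≡ (55 * a + 23) * 12
  even-numerator = solve-∀
  odd-numerator : ∀ a → 1 + 7 * (12 * a + 5) ≡ (7 * a + 3) * 12
  odd-numerator = solve-∀
  step : ∀ a → 55 * a + 23 ≡ (7 * a + 3) + 4 * (12 * a + 5)
  step = solve-∀

U5-cSeries-odd : ∀ k → isOdd k ≡ true → U 5 (cSeries k) ≗ cSeries (suc k)
U5-cSeries-odd k odd zero    = refl
U5-cSeries-odd k odd (suc j) = cong c (begin
  5 ^ k * (j + 4 * suc j) + lam k        ≡⟨ regroup (5 ^ k) (lam k) j ⟩
  5 ^ suc k * j + (lam k + 4 * 5 ^ k)    ≡⟨ cong (λ l → 5 ^ suc k * j + l) (lam-suc-odd k odd) ⟨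
  5 ^ suc k * j + lam (suc k)            ∎)
  where
  open ≡-Reasoning
  regroup : ∀ p l j → p * (j + 4 * suc j) + l ≡ 5 * p * j + (l + 4 * p)
  regroup = solve-∀

U5-shiftS-cSeries-even : ∀ k (C : Series) → isOdd k ≡ false → (∀ n → C (suc n) ≡ c (5 ^ k * n + lam k)) →
  U 5 (shiftS 2 C) ≗ cSeries (suc k)
U5-shiftS-cSeries-even k C even C-suc zero    = refl
U5-shiftS-cSeries-even k C even C-suc (suc j) = begin
  shiftS 2 C (5 * suc j)                 ≡⟨ cong (shiftS 2 C) (expand j) ⟩
  shiftS 2 C (2 + suc (5 * j + 2))       ≡⟨ shiftS-≥ 2 C _ (ℕ.m≤m+n 2 _) ⟩
  C (suc (5 * j + 2))                    ≡⟨ C-suc (5 * j + 2) ⟩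
  c (5 ^ k * (5 * j + 2) + lam k)        ≡⟨ cong c (regroup (5 ^ k) (lam k) j) ⟩
  c (5 ^ suc k * j + (lam k + 2 * 5 ^ k)) ≡⟨ cong (λ l → c (5 ^ suc k * j + l)) (lam-suc-even k even) ⟨
  c (5 ^ suc k * j + lam (suc k))        ∎
  where
  open ≡-Reasoning
  expand : ∀ j → 5 * suc j ≡ 2 + suc (5 * j + 2)
  expand = solve-∀
  regroup : ∀ p l j → p * (5 * j + 2) + l ≡ 5 * p * j + (l + 2 * p)
  regroup = solve-∀

dilate-oneS : ∀ d .{{_ : NonZero d}} → dilate d oneS ≗ oneS
dilate-oneS d@(suc _) = begin
  dilate d oneS         ≈⟨ dilate-cong d U-oneS ⟨
  dilate d (U d oneS)   ≈⟨ dilate-U d oneS oneS-vanishesOff ⟩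
  oneS                  ∎
  where
  open ≗-Reasoning
  U-oneS : U d oneS ≗ oneS
  U-oneS zero    = cong oneS (ℕ.*-zeroʳ d)
  U-oneS (suc m) = refl
  oneS-vanishesOff : VanishesOffMultiplesOf d oneS
  oneS-vanishesOff zero    d∤0 = ⊥-elim (d∤0 (divides 0 refl))
  oneS-vanishesOff (suc n) _   = refl

qPochK-⊛-inverse : ∀ d .{{_ : NonZero d}} → qPochK d ⊛ dilate d qPochInv ≗ oneS
qPochK-⊛-inverse d = begin
  dilate d qPoch ⊛ dilate d qPochInv   ≈⟨ dilate-⊛ d qPoch qPochInv ⟨
  dilate d (qPoch ⊛ qPochInv)          ≈⟨ dilate-cong d (λ n → trans (⊛-comm qPoch qPochInv n) (qPochInv-⊛-qPoch n)) ⟩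
  dilate d oneS                        ≈⟨ dilate-oneS d ⟩
  oneS                                 ∎
  where open ≗-Reasoning

U-qPochK-⊛ : ∀ d k .{{_ : NonZero d}} .{{_ : NonZero k}} .{{_ : NonZero (d * k)}} g →
  U d (qPochK (d * k) ⊛ g) ≗ qPochK k ⊛ U d g
U-qPochK-⊛ d k g m = trans (⊛-congˡ g (dilate-* d k qPoch) (d * m)) (U-dilate-⊛ d (qPochK k) g m)

L0-factor : L0 ≗ qPochK 2 ⊛ c
L0-factor = begin
  L0                                   ≈⟨ ⊛-identityʳ L0 ⟨
  L0 ⊛ oneS                            ≈⟨ ⊛-congʳ L0 (qPochK-⊛-inverse 2) ⟨
  L0 ⊛ (qPochK 2 ⊛ dilate 2 qPochInv)  ≈⟨ ⊛-x∙yz≈y∙xz L0 (qPochK 2) (dilate 2 qPochInv) ⟩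
  qPochK 2 ⊛ c                         ∎
  where open ≗-Reasoning

L-suc-odd : ∀ k → isOdd (suc k) ≡ true → L (suc k) ≡ qPochK 10 ⊛ cSeries (suc k)
L-suc-odd k odd rewrite odd = refl

L-suc-even : ∀ k → isOdd (suc k) ≡ false → L (suc k) ≡ qPochK 2 ⊛ cSeries (suc k)
L-suc-even k even rewrite even = refl

-- For k = 0 the cofactor is c itself, which differs from cSeries 0 in degree 0 only; after the
-- factor q² in Z that coefficient no longer matters.
L-even-factor : ∀ k → isOdd k ≡ false →
  Σ Series λ C → (L k ≗ qPochK 2 ⊛ C) × (∀ n → C (suc n) ≡ c (5 ^ k * n + lam k))
L-even-factor zero    _    = c , L0-factor , λ n → cong c (suc≡1*n+1 n)
  where suc≡1*n+1 : ∀ n → suc n ≡ 1 * n + 1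
        suc≡1*n+1 = solve-∀
L-even-factor (suc k) even = cSeries (suc k) , (λ n → cong (λ f → f n) (L-suc-even k even)) , λ _ → refl

Z-⊛-qPochK2 : ∀ C → Z ⊛ (qPochK 2 ⊛ C) ≗ qPochK 50 ⊛ shiftS 2 C
Z-⊛-qPochK2 C = begin
  Z ⊛ (qPochK 2 ⊛ C)
    ≈⟨ ⊛-comm Z (qPochK 2 ⊛ C) ⟩
  (qPochK 2 ⊛ C) ⊛ shiftS 2 (qPochK 50 ⊛ dilate 2 qPochInv)
    ≈⟨ ⊛-shiftS 2 (qPochK 2 ⊛ C) (qPochK 50 ⊛ dilate 2 qPochInv) ⟩
  shiftS 2 ((qPochK 2 ⊛ C) ⊛ (qPochK 50 ⊛ dilate 2 qPochInv))
    ≈⟨ shiftS-cong 2 regroup ⟩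
  shiftS 2 (qPochK 50 ⊛ C)
    ≈⟨ ⊛-shiftS 2 (qPochK 50) C ⟨
  qPochK 50 ⊛ shiftS 2 C ∎
  where
  open ≗-Reasoning
  regroup : (qPochK 2 ⊛ C) ⊛ (qPochK 50 ⊛ dilate 2 qPochInv) ≗ qPochK 50 ⊛ C
  regroup = begin
    (qPochK 2 ⊛ C) ⊛ (qPochK 50 ⊛ dilate 2 qPochInv) ≈⟨ ⊛-congʳ (qPochK 2 ⊛ C) (⊛-comm (qPochK 50) (dilate 2 qPochInv)) ⟩
    (qPochK 2 ⊛ C) ⊛ (dilate 2 qPochInv ⊛ qPochK 50) ≈⟨ ⊛-interchange (qPochK 2) C (dilate 2 qPochInv) (qPochK 50) ⟩
    (qPochK 2 ⊛ dilate 2 qPochInv) ⊛ (C ⊛ qPochK 50) ≈⟨ ⊛-congˡ (C ⊛ qPochK 50) (qPochK-⊛-inverse 2) ⟩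
    oneS ⊛ (C ⊛ qPochK 50)                           ≈⟨ ⊛-identityˡ (C ⊛ qPochK 50) ⟩
    C ⊛ qPochK 50                                    ≈⟨ ⊛-comm C (qPochK 50) ⟩
    qPochK 50 ⊛ C                                    ∎

L-odd-step : ∀ k → isOdd k ≡ true → L (suc k) ≗ U5 (L k)
L-odd-step zero    ()
L-odd-step (suc k) odd = begin
  L (suc (suc k))                       ≡⟨ L-suc-even (suc k) (cong not odd) ⟩
  qPochK 2 ⊛ cSeries (suc (suc k))      ≈⟨ ⊛-congʳ (qPochK 2) (U5-cSeries-odd (suc k) odd) ⟨
  qPochK 2 ⊛ U 5 (cSeries (suc k))      ≈⟨ U-qPochK-⊛ 5 2 (cSeries (suc k)) ⟨
  U 5 (qPochK 10 ⊛ cSeries (suc k))     ≡⟨ cong U5 (L-suc-odd k odd) ⟨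
  U5 (L (suc k))                        ∎
  where open ≗-Reasoning

L-even-step : ∀ k → isOdd k ≡ false → L (suc k) ≗ U5 (Z ⊛ L k)
L-even-step k even with L-even-factor k even
... | C , L≗ , C-suc = begin
  L (suc k)                             ≡⟨ L-suc-odd k (cong not even) ⟩
  qPochK 10 ⊛ cSeries (suc k)           ≈⟨ ⊛-congʳ (qPochK 10) (U5-shiftS-cSeries-even k C even C-suc) ⟨
  qPochK 10 ⊛ U 5 (shiftS 2 C)          ≈⟨ U-qPochK-⊛ 5 10 (shiftS 2 C) ⟨
  U 5 (qPochK 50 ⊛ shiftS 2 C)          ≈⟨ (λ m → Z-⊛-qPochK2 C (5 * m)) ⟨
  U 5 (Z ⊛ (qPochK 2 ⊛ C))              ≈⟨ (λ m → ⊛-congʳ Z L≗ (5 * m)) ⟨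
  U5 (Z ⊛ L k)                          ∎
  where open ≗-Reasoning

lemma2p3 : ((α : ℕ) → 1 ≤ α → (n : ℕ) → L (2 * α) n ≡ U5 (L (2 * α ∸ 1)) n)
    × ((α : ℕ) → (n : ℕ) → L (2 * α + 1) n ≡ U5 (Z ⊛ L (2 * α)) n)
lemma2p3 = odd-to-even , even-to-odd
  where
  odd-to-even : (α : ℕ) → 1 ≤ α → (n : ℕ) → L (2 * α) n ≡ U5 (L (2 * α ∸ 1)) n
  odd-to-even (suc β) _ = L-odd-step (2 * suc β ∸ 1) (not-injective (isOdd-double (suc β)))
  even-to-odd : (α : ℕ) → (n : ℕ) → L (2 * α + 1) n ≡ U5 (Z ⊛ L (2 * α)) n
  even-to-odd α rewrite ℕ.+-comm (2 * α) 1 = L-even-step (2 * α) (isOdd-double α)
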